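{- Let $f,g$ be problems and $k\in\mathbb{N}$ positive. (i) If $f\le^*_W g$ and $g$ is $k$-weakly continuous, then $f$ is $k$-weakly continuous. (ii) If $f$ and $g$ are both $k$-weakly continuous, then $f\circ g$ is $k$-weakly continuous.
   Context: A problem is a partial multivalued function $f:\subseteq \mathbb{N}^\mathbb{N} \rightrightarrows \mathbb{N}^\mathbb{N}$; $\mathrm{dom}(f)$ is the set of $x$ with $f(x)\neq\emptyset$. Fix a standard computable pairing $\langle x,y\rangle$. $f\le^*_W g$ iff there are partial continuous $h,k:\subseteq\mathbb{N}^\mathbb{N}\to\mathbb{N}^\mathbb{N}$ such that for every $x\in\mathrm{dom}(f)$, $k(x)\in\mathrm{dom}(g)$ and for every $y\in g(k(x))$, $h(\langle x,y\rangle)\in f(x)$. The composition $f\circ g$ has domain $\{x\in\mathrm{dom}(g) : g(x)\subseteq \mathrm{dom}(f)\}$ and $(f\circ g)(x)=\{z : \exists y\in g(x),\ z\in f(y)\}$. For $x\in\mathbb{N}^\mathbb{N}$, $x|_n$ is its initial segment of length $n$. For positive $k$, $f$ is $k$-weakly continuous iff for every $x\in\mathrm{dom}(f)$ and every sequence $(y_n)_{n\in\mathbb{N}}\subseteq\mathrm{dom}(f)$ with $\lim_{n\to\infty}y_n=x$, there is $u\in f(x)$ such that for every $l<k$ and every $m\in\mathbb{N}$ there exist $n\ge m$ and $v\in f(y_{n\cdot k+l})$ with $u|_m=v|_m$. -}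

module Defs where

open import Data.Nat using (ℕ; zero; suc; _+_; _*_; _≤_; _<_)
open import Data.Nat.DivMod using (_/_; _%_)
open import Data.Fin using (toℕ)
open import Data.Vec using (Vec; tabulate)
open import Data.Product using (Σ; ∃; _×_; _,_)
open import Relation.Binary.PropositionalEquality using (_≡_)

Baire : Set
Baire = ℕ → ℕ

_∣_ : Baire → (n : ℕ) → Vec ℕ n
x ∣ n = tabulate (λ i → x (toℕ i))

⟨_,_⟩ : Baire → Baire → Baire
⟨ x , y ⟩ n with n % 2
... | zero = x (n / 2)
... | suc _ = y (n / 2)

-- a problem f :⊆ ℕ^ℕ ⇉ ℕ^ℕ, given by the relation  y ∈ f(x)  (written  F x y)
Problem : Set₁
Problem = Baire → Baire → Set

dom : Problem → Baire → Set
dom F x = ∃ λ y → F x y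

record PartialFun : Set₁ where
  field
    D   : Baire → Set
    app : (x : Baire) → D x → Baire
open PartialFun public

Continuous : PartialFun → Set
Continuous h = ∀ x (dx : D h x) (m : ℕ) → ∃ λ N →
  ∀ x' (dx' : D h x') → x ∣ N ≡ x' ∣ N → app h x dx ∣ m ≡ app h x' dx' ∣ m

_≤W*_ : Problem → Problem → Set₁
F ≤W* G = Σ PartialFun λ h → Σ PartialFun λ k →
  Continuous h × Continuous k ×
  (∀ x → dom F x →
     Σ (D k x) λ dk → dom G (app k x dk) ×
       (∀ y → G (app k x dk) y →
          Σ (D h ⟨ x , y ⟩) λ dh → F x (app h ⟨ x , y ⟩ dh)))

_∘P_ : Problem → Problem → Problem
(F ∘P G) x z = (dom G x × (∀ y → G x y → dom F y)) × (∃ λ y → G x y × F y z)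

Converges : (ℕ → Baire) → Baire → Set
Converges y x = ∀ m → ∃ λ N → ∀ n → N ≤ n → y n ∣ m ≡ x ∣ m

WeaklyContinuous : ℕ → Problem → Set
WeaklyContinuous k F =
  ∀ x → dom F x → (y : ℕ → Baire) → (∀ n → dom F (y n)) → Converges y x →
  ∃ λ u → F x u ×
    (∀ l → l < k → ∀ m → ∃ λ n → m ≤ n × ∃ λ v → F (y (n * k + l)) v × u ∣ m ≡ v ∣ m)

{-# OPTIONS --safe #-}
-- (i) The forward map r of the reduction is continuous, so it carries y → x to r ∘ y → r x;
-- weak continuity of G gives u ∈ G (r x) approximated along every residue class by solutions v
-- at the r (y i), and the continuous backward map h sends ⟨ x , u ⟩ and the ⟨ y i , v ⟩ to
-- solutions of F that agree just as long.
-- (ii) Take u ∈ G x approximated along y. Listing its approximants row by row over the k residue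
-- classes gives a sequence w → u whose i-th term solves G at an index of y that grows with i / k
-- and stays in class i % k; weak continuity of F at u along w then yields the solution z.
module Submission where

open import Defs
open import Data.Nat using (ℕ; suc; _<_; _+_; _*_; _≤_; _⊔_; NonZero; >-nonZero)
open import Data.Nat.Properties
open import Data.Nat.DivMod
open import Data.Nat.Divisibility using (divides-refl)
open import Data.Fin using (toℕ; fromℕ<)
open import Data.Fin.Properties using (toℕ<n; toℕ-fromℕ<)
open import Data.Vec using (lookup)
open import Data.Vec.Properties using (lookup∘tabulate; tabulate-cong)
open import Data.Product using (_×_; _,_; proj₁; proj₂; ∃; ∃₂)
open import Relation.Binary.PropositionalEquality

∣≡⇒≡ : ∀ {m} x y → x ∣ m ≡ y ∣ m → ∀ {i} → i < m → x i ≡ y i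
∣≡⇒≡ x y x∣m≡y∣m {i} i<m = begin
  x i                                   ≡⟨ cong x (toℕ-fromℕ< i<m) ⟨
  x (toℕ j)                             ≡⟨ lookup∘tabulate (λ j → x (toℕ j)) j ⟨
  lookup (x ∣ _) j                      ≡⟨ cong (λ v → lookup v j) x∣m≡y∣m ⟩
  lookup (y ∣ _) j                      ≡⟨ lookup∘tabulate (λ j → y (toℕ j)) j ⟩
  y (toℕ j)                             ≡⟨ cong y (toℕ-fromℕ< i<m) ⟩
  y i                                   ∎
  where open ≡-Reasoning; j = fromℕ< i<m

≡⇒∣≡ : ∀ {m} x y → (∀ {i} → i < m → x i ≡ y i) → x ∣ m ≡ y ∣ m
≡⇒∣≡ x y x≡y = tabulate-cong (λ j → x≡y (toℕ<n j))

∣≡-restrict : ∀ {m n} x y → m ≤ n → x ∣ n ≡ y ∣ n → x ∣ m ≡ y ∣ m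
∣≡-restrict x y m≤n x∣n≡y∣n = ≡⇒∣≡ x y (λ i<m → ∣≡⇒≡ x y x∣n≡y∣n (≤-trans i<m m≤n))

⟨,⟩-∣≡ : ∀ {m} x y u v → x ∣ m ≡ y ∣ m → u ∣ m ≡ v ∣ m → ⟨ x , u ⟩ ∣ m ≡ ⟨ y , v ⟩ ∣ m
⟨,⟩-∣≡ x y u v x∣m≡y∣m u∣m≡v∣m = ≡⇒∣≡ ⟨ x , u ⟩ ⟨ y , v ⟩ agree
  where
  agree : ∀ {i} → i < _ → ⟨ x , u ⟩ i ≡ ⟨ y , v ⟩ i
  agree {i} i<m with i % 2
  ... | 0     = ∣≡⇒≡ x y x∣m≡y∣m (≤-<-trans (m/n≤m i 2) i<m)
  ... | suc _ = ∣≡⇒≡ u v u∣m≡v∣m (≤-<-trans (m/n≤m i 2) i<m)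

Converges-continuous : ∀ h (h-cont : Continuous h) {x y} (hx : D h x) (hy : ∀ n → D h (y n)) →
  Converges y x → Converges (λ n → app h (y n) (hy n)) (app h x hx)
Converges-continuous h h-cont {x} {y} hx hy y→x m with h-cont x hx m
... | N , cont with y→x N
...   | n₀ , close = n₀ , λ n n₀≤n → sym (cont (y n) (hy n) (sym (close n n₀≤n)))

Converges-if-∣≡ : ∀ {u w} (φ : ℕ → ℕ) → (∀ m → ∃ λ N → ∀ n → N ≤ n → m ≤ φ n) →
  (∀ n → u ∣ φ n ≡ w n ∣ φ n) → Converges w u
Converges-if-∣≡ {u} {w} φ φ→∞ u≈w m with φ→∞ m
... | N , m≤φ = N , λ n N≤n → sym (∣≡-restrict u (w n) (m≤φ n N≤n) (u≈w n))

[m*n+o]/n≡m : ∀ m n {o} .{{_ : NonZero n}} → o < n → (m * n + o) / n ≡ m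
[m*n+o]/n≡m m n {o} o<n = begin
  (m * n + o) / n     ≡⟨ +-distrib-/-∣ˡ o (divides-refl m) ⟩
  m * n / n + o / n   ≡⟨ cong₂ _+_ (m*n/n≡m m n) (m<n⇒m/n≡0 o<n) ⟩
  m + 0               ≡⟨ +-identityʳ m ⟩
  m                   ∎
  where open ≡-Reasoning

[m*n+o]%n≡o : ∀ m n {o} .{{_ : NonZero n}} → o < n → (m * n + o) % n ≡ o
[m*n+o]%n≡o m n {o} o<n = begin
  (m * n + o) % n   ≡⟨ cong (_% n) (+-comm (m * n) o) ⟩
  (o + m * n) % n   ≡⟨ [m+kn]%n≡m%n o m n ⟩
  o % n             ≡⟨ m<n⇒m%n≡m o<n ⟩
  o                 ∎
  where open ≡-Reasoning

m≤m*n+o : ∀ m n o .{{_ : NonZero n}} → m ≤ m * n + o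
m≤m*n+o m n o = ≤-trans (m≤m*n m n) (m≤m+n (m * n) o)

dom-∘P : ∀ {F G x} → dom (F ∘P G) x → dom G x × (∀ y → G x y → dom F y)
dom-∘P (_ , x∈dom , _) = x∈dom

Approximated : ℕ → Problem → (ℕ → Baire) → Baire → Set
Approximated k F y u =
  ∀ l → l < k → ∀ m → ∃ λ n → m ≤ n × ∃ λ v → F (y (n * k + l)) v × u ∣ m ≡ v ∣ m

module _ (k : ℕ) .{{_ : NonZero k}} where

  interleave-Approximated : ∀ {G y u} → Approximated k G y u →
    ∃₂ λ (idx : ℕ → ℕ) (w : ℕ → Baire) → Converges w u ×
      (∀ i → i / k ≤ idx i × G (y (idx i * k + i % k)) (w i))
  interleave-Approximated {G} {y} {u} approx =
    idx , w , Converges-if-∣≡ {u} {w} (_/ k) /k→∞ (λ i → proj₂ (proj₂ (proj₂ (proj₂ (cell i))))) ,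
    (λ i → proj₁ (proj₂ (cell i)) , proj₁ (proj₂ (proj₂ (proj₂ (cell i)))))
    where
    cell : ∀ i → ∃ λ n → i / k ≤ n × ∃ λ v → G (y (n * k + i % k)) v × u ∣ (i / k) ≡ v ∣ (i / k)
    cell i = approx (i % k) (m%n<n i k) (i / k)

    idx : ℕ → ℕ
    idx i = proj₁ (cell i)

    w : ℕ → Baire
    w i = proj₁ (proj₂ (proj₂ (cell i)))

    /k→∞ : ∀ m → ∃ λ N → ∀ n → N ≤ n → m ≤ n / k
    /k→∞ m = m * k , λ n mk≤n → subst (_≤ n / k) (m*n/n≡m m k) (/-monoˡ-≤ k mk≤n)

  ≤W*-WeaklyContinuous : ∀ {F G} → F ≤W* G → WeaklyContinuous k G → WeaklyContinuous k F
  ≤W*-WeaklyContinuous {F} {G} (h , r , h-cont , r-cont , reduce) wcG x x∈F y y∈F y→x =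
    app h ⟨ x , u ⟩ hxu , proj₂ (lift x x∈F u u∈G) , approx
    where
    lift : ∀ x (x∈F : dom F x) v → G (app r x (proj₁ (reduce x x∈F))) v →
      ∃ λ (hxv : D h ⟨ x , v ⟩) → F x (app h ⟨ x , v ⟩ hxv)
    lift x x∈F = proj₂ (proj₂ (reduce x x∈F))

    ry : ∀ n → D r (y n)
    ry n = proj₁ (reduce (y n) (y∈F n))

    rx : D r x
    rx = proj₁ (reduce x x∈F)

    wc : ∃ λ u → G (app r x rx) u × Approximated k G (λ n → app r (y n) (ry n)) u
    wc = wcG _ (proj₁ (proj₂ (reduce x x∈F))) _ (λ n → proj₁ (proj₂ (reduce (y n) (y∈F n))))
             (Converges-continuous r r-cont rx ry y→x)

    u : Baire
    u = proj₁ wc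

    u∈G : G (app r x rx) u
    u∈G = proj₁ (proj₂ wc)

    hxu : D h ⟨ x , u ⟩
    hxu = proj₁ (lift x x∈F u u∈G)

    -- Agreement up to N of both components of the pairs makes their h-images agree up to m.
    approx : Approximated k F y (app h ⟨ x , u ⟩ hxu)
    approx l l<k m with h-cont ⟨ x , u ⟩ hxu m
    ... | N , h-close with y→x N
    ...   | n₀ , y-close with proj₂ (proj₂ wc) l l<k (m ⊔ N ⊔ n₀)
    ...     | n , bound≤n , v , v∈G , u≈v =
      n , m⊔n≤o⇒m≤o m N (m⊔n≤o⇒m≤o (m ⊔ N) n₀ bound≤n) ,
      app h ⟨ y i , v ⟩ hyv , proj₂ (lift (y i) (y∈F i) v v∈G) ,
      h-close _ hyv (⟨,⟩-∣≡ x (y i) u v (sym (y-close i n₀≤i))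
                                       (∣≡-restrict u v N≤bound u≈v))
      where
      i : ℕ
      i = n * k + l

      hyv : D h ⟨ y i , v ⟩
      hyv = proj₁ (lift (y i) (y∈F i) v v∈G)

      N≤bound : N ≤ m ⊔ N ⊔ n₀
      N≤bound = m⊔n≤o⇒n≤o m N (m≤m⊔n (m ⊔ N) n₀)

      n₀≤i : n₀ ≤ i
      n₀≤i = ≤-trans (≤-trans (m≤n⊔m (m ⊔ N) n₀) bound≤n) (m≤m*n+o n k l)

  ∘P-WeaklyContinuous : ∀ {F G} → WeaklyContinuous k F → WeaklyContinuous k G →
    WeaklyContinuous k (F ∘P G)
  ∘P-WeaklyContinuous {F} {G} wcF wcG x x∈F∘G y y∈F∘G y→x
    with dom-∘P {F} {G} x∈F∘G
  ... | x∈G , Gx⊆F with wcG x x∈G y (λ n → proj₁ (dom-∘P {F} {G} (y∈F∘G n))) y→x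
  ...   | u , u∈G , u-approx with interleave-Approximated {G} {y} {u} u-approx
  ...     | idx , w , w→u , w-row
    with wcF u (Gx⊆F u u∈G) w (λ i → proj₂ (dom-∘P {F} {G} (y∈F∘G _)) (w i) (proj₂ (w-row i))) w→u
  ...       | z , z∈F , z-approx = z , ((x∈G , Gx⊆F) , u , u∈G , z∈F) , approx
    where
    approx : Approximated k (F ∘P G) y z
    approx l l<k m with z-approx l l<k m
    ... | j , m≤j , t , t∈F , z≈t =
      idx i , ≤-trans m≤j (subst (_≤ idx i) ([m*n+o]/n≡m j k l<k) (proj₁ (w-row i))) ,
      t , (dom-∘P {F} {G} (y∈F∘G _) , w i , wi∈G , t∈F) , z≈t
      where
      i : ℕ
      i = j * k + l

      wi∈G : G (y (idx i * k + l)) (w i)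
      wi∈G = subst (λ r → G (y (idx i * k + r)) (w i)) ([m*n+o]%n≡o j k l<k) (proj₂ (w-row i))

lemma3p3 : (F G : Problem) (k : ℕ) → 0 < k →
    (F ≤W* G → WeaklyContinuous k G → WeaklyContinuous k F) ×
    (WeaklyContinuous k F → WeaklyContinuous k G → WeaklyContinuous k (F ∘P G))
lemma3p3 F G k 0<k = ≤W*-WeaklyContinuous k , ∘P-WeaklyContinuous k
  where instance _ = >-nonZero 0<k
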